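{- Let $(G,T)$ be a terminal network and $S\subseteq V(G)$. Let $(G_S,T(S))$ be the recursive instance at $S$, let $Z_S$ be a multicut-covering set for $(G_S,T(S))$, and let $e\in E(G_S)\setminus Z_S$. Then $e$ is not essential for $(G,T)$.
   Context: Graphs are undirected. For $S\subseteq V(G)$, $N_G(S)$ is the set of vertices outside $S$ adjacent to $S$, $N_G[S]=S\cup N_G(S)$; $G_S=G[N_G[S]]-E(N_G(S))$ (i.e., $G[S]$ together with the edges having exactly one endpoint in $S$), regarded with $E(G_S)\subseteq E(G)$, and $T(S)=(T\cap S)\cup N_G(S)$. The recursive instance at $S$ is the terminal network $(G_S,T(S))$. For a set of cut requests $R\subseteq\binom{T}{2}$, a multicut for $R$ in $G$ is a set $X\subseteq E(G)$ such that each connected component of $G-X$ contains at most one member of each pair in $R$; minimum means minimum cardinality. A multicut-covering set for a terminal network $(H,U)$ is a set $Z\subseteq E(H)$ such that for every $R\subseteq\binom{U}{2}$ there is a minimum multicut $X$ for $R$ in $H$ with $X\subseteq Z$. An edge $e$ is essential for $(G,T)$ if there is some $R\subseteq\binom{T}{2}$ such that every minimum multicut for $R$ in $G$ contains $e$. -}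

module Defs where

open import Data.Nat using (ℕ; _≤_)
open import Data.Fin using (Fin)
open import Data.Fin.Subset using (Subset; _∈_; _∉_; ∣_∣)
open import Data.Product using (_×_; _,_; Σ; ∃)
open import Data.Sum using (_⊎_)
open import Data.Unit using (⊤)
open import Relation.Binary.PropositionalEquality using (_≡_; _≢_)
open import Relation.Nullary using (¬_)

record Graph (n m : ℕ) : Set where
  field
    ends      : Fin m → Fin n × Fin n
    noLoop    : ∀ e u v → ends e ≡ (u , v) → u ≢ v
    noParallel : ∀ e f u v → ends e ≡ (u , v) → (ends f ≡ (u , v) ⊎ ends f ≡ (v , u)) → e ≡ f
open Graph public

module _ {n m : ℕ} (G : Graph n m) where

  Joins : Fin m → Fin n → Fin n → Set
  Joins e u v = ends G e ≡ (u , v) ⊎ ends G e ≡ (v , u)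

  -- Edge sets of subgraphs of G are predicates on Fin m ("E(H) ⊆ E(G)").
  -- Reach F u v : u and v lie in the same connected component of the
  -- graph whose edges are those satisfying F.
  data Reach (F : Fin m → Set) : Fin n → Fin n → Set where
    here : ∀ {u} → Reach F u u
    step : ∀ {u v w} (e : Fin m) → F e → Joins e u v → Reach F v w → Reach F u w

  Minus : (Fin m → Set) → Subset m → Fin m → Set
  Minus F X e = F e × e ∉ X

  -- Cut requests R ⊆ binom(U,2) (U a vertex set), given as a relation
  Requests : (Fin n → Set) → (Fin n → Fin n → Set) → Set
  Requests U R = ∀ s t → R s t → U s × U t × s ≢ t

  IsMulticut : (Fin m → Set) → (Fin n → Fin n → Set) → Subset m → Set
  IsMulticut F R X = (∀ e → e ∈ X → F e) × (∀ s t → R s t → ¬ Reach (Minus F X) s t)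

  IsMinMulticut : (Fin m → Set) → (Fin n → Fin n → Set) → Subset m → Set
  IsMinMulticut F R X = IsMulticut F R X × (∀ Y → IsMulticut F R Y → ∣ X ∣ ≤ ∣ Y ∣)

  MulticutCovering : (Fin m → Set) → (Fin n → Set) → Subset m → Set₁
  MulticutCovering F U Z =
    (∀ e → e ∈ Z → F e) ×
    (∀ (R : Fin n → Fin n → Set) → Requests U R →
       Σ (Subset m) λ X → IsMinMulticut F R X × (∀ e → e ∈ X → e ∈ Z))

  AllEdges : Fin m → Set
  AllEdges _ = ⊤

  Essential : Subset n → Fin m → Set₁
  Essential T e =
    Σ (Fin n → Fin n → Set) λ R → Requests (_∈ T) R ×
      (∀ X → IsMinMulticut AllEdges R X → e ∈ X)

  Nbr : (Fin n → Set) → Fin n → Set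
  Nbr S v = ¬ S v × ∃ λ e → ∃ λ w → S w × Joins e v w

  TS : Subset n → (Fin n → Set) → Fin n → Set
  TS T S v = (v ∈ T × S v) ⊎ Nbr S v

  -- E(G_S): edges of G[N[S]] not inside N(S) = edges with at least one endpoint in S
  ES : (Fin n → Set) → Fin m → Set
  ES S e = ∃ λ u → ∃ λ v → ends G e ≡ (u , v) × (S u ⊎ S v)

-- The goal is a negation, so we may argue classically: take S decidable and fix a minimum
-- multicut X for the requests R witnessing essentiality. The covering set yields a minimum
-- multicut Y ⊆ Z in G_S for the pairs of T(S) that X separates. As X ∩ E(G_S) is one such
-- multicut, |Y| ≤ |X ∩ E(G_S)|, so X′ = (X ∖ E(G_S)) ∪ Y is no larger than X. And X′ still
-- cuts R: a path of G − X′ alternates between edges outside G_S, which avoid X, and maximal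
-- stretches inside G_S, which avoid Y and run between vertices of T(S), hence between
-- vertices not separated by X. Thus X′ is a minimum multicut for R, and it misses
-- e ∈ E(G_S) ∖ Z.

module Submission where

open import Defs
open import Data.Nat.Base using (ℕ; zero; suc; _+_; _≤_; _<_; z≤n; s≤s)
open import Data.Nat.Properties using (≤-trans; ≤-reflexive; ≮⇒≥; n≤1+n; +-suc; +-monoʳ-≤; module ≤-Reasoning)
open import Data.Nat.Induction using (<-wellFounded)
open import Data.Fin using (Fin; zero; suc; _≟_)
open import Data.Fin.Subset using (Subset; _∈_; _∉_; ∣_∣; _∪_; _∩_; _─_; outside; inside)
import Data.Fin.Subset as Subset
open import Data.Fin.Subset.Properties using (x∈p∪q⁺; x∈p∪q⁻; x∈p∩q⁺; x∈p∩q⁻; x∈p∧x∉q⇒x∈p─q; ∈⊤)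
open import Data.Vec.Base using ([]; _∷_; lookup; tabulate; here; there)
open import Data.Vec.Properties using ([]=⇒lookup; lookup⇒[]=; lookup∘tabulate)
open import Data.Product using (_×_; _,_; ∃; ∃₂; proj₁; proj₂)
open import Data.Sum using (_⊎_; inj₁; inj₂; [_,_]′)
open import Data.Unit using (tt)
open import Data.Empty using (⊥-elim)
open import Function.Base using (_∘_)
open import Induction.WellFounded using (Acc; acc)
open import Relation.Binary.PropositionalEquality using (_≡_; _≢_; refl; sym; trans; cong; subst)
open import Relation.Nullary using (¬_; yes; no; does)
open import Relation.Nullary.Decidable using (_⊎-dec_; dec-true; ¬¬-excluded-middle)
open import Relation.Nullary.Negation using (¬¬-map)
open import Relation.Unary using (Decidable)

¬¬-∀-Fin : ∀ {k} {P : Fin k → Set} → (∀ i → ¬ ¬ P i) → ¬ ¬ (∀ i → P i)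
¬¬-∀-Fin {zero}  _  k = k λ ()
¬¬-∀-Fin {suc _} ¬¬P k = ¬¬P zero λ P0 → ¬¬-∀-Fin (¬¬P ∘ suc) λ Psuc →
  k λ { zero → P0 ; (suc i) → Psuc i }

¬¬-minimum : ∀ {A : Set} (μ : A → ℕ) {P : A → Set} {x : A} →
  P x → ¬ ¬ (∃ λ y → P y × ∀ z → P z → μ y ≤ μ z)
¬¬-minimum μ {P} = go (<-wellFounded _)
  where
  go : ∀ {x} → Acc _<_ (μ x) → P x → ¬ ¬ (∃ λ y → P y × ∀ z → P z → μ y ≤ μ z)
  go {x} (acc smaller) Px k = ¬¬-excluded-middle {A = ∃ λ y → P y × μ y < μ x} λ where
    (yes (y , Py , μy<μx)) → go (smaller μy<μx) Py k
    (no ¬below) → k (x , Px , λ z Pz → ≮⇒≥ λ μz<μx → ¬below (z , Pz , μz<μx))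

fromDec : ∀ {k} {P : Fin k → Set} → Decidable P → Subset k
fromDec P? = tabulate (λ i → does (P? i))

module _ {k} {P : Fin k → Set} (P? : Decidable P) {i : Fin k} where

  lookup-fromDec : lookup (fromDec P?) i ≡ does (P? i)
  lookup-fromDec = lookup∘tabulate (λ i → does (P? i)) i

  ∈-fromDec⁺ : P i → i ∈ fromDec P?
  ∈-fromDec⁺ Pi = lookup⇒[]= i _ (trans lookup-fromDec (dec-true (P? i) Pi))

  ∈-fromDec⁻ : i ∈ fromDec P? → P i
  ∈-fromDec⁻ i∈ with P? i | lookup-fromDec
  ... | yes Pi | _  = Pi
  ... | no _   | eq with trans (sym ([]=⇒lookup i∈)) eq
  ...   | ()

x∈p─q⇒x∉q : ∀ {k} {x : Fin k} (p q : Subset k) → x ∈ p ─ q → x ∉ q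
x∈p─q⇒x∉q (inside ∷ p) (outside ∷ q) here      = λ ()
x∈p─q⇒x∉q (_ ∷ p)      (_ ∷ q)       (there x∈) (there x∈q) = x∈p─q⇒x∉q p q x∈ x∈q

∣p∪q∣≤∣p∣+∣q∣ : ∀ {k} (p q : Subset k) → ∣ p ∪ q ∣ ≤ ∣ p ∣ + ∣ q ∣
∣p∪q∣≤∣p∣+∣q∣ []            []            = z≤n
∣p∪q∣≤∣p∣+∣q∣ (inside ∷ p)  (inside ∷ q)  = s≤s (≤-trans (∣p∪q∣≤∣p∣+∣q∣ p q) (+-monoʳ-≤ ∣ p ∣ (n≤1+n ∣ q ∣)))
∣p∪q∣≤∣p∣+∣q∣ (inside ∷ p)  (outside ∷ q) = s≤s (∣p∪q∣≤∣p∣+∣q∣ p q)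
∣p∪q∣≤∣p∣+∣q∣ (outside ∷ p) (inside ∷ q)  = ≤-trans (s≤s (∣p∪q∣≤∣p∣+∣q∣ p q)) (≤-reflexive (sym (+-suc ∣ p ∣ ∣ q ∣)))
∣p∪q∣≤∣p∣+∣q∣ (outside ∷ p) (outside ∷ q) = ∣p∪q∣≤∣p∣+∣q∣ p q

∣p─q∣+∣p∩q∣≡∣p∣ : ∀ {k} (p q : Subset k) → ∣ p ─ q ∣ + ∣ p ∩ q ∣ ≡ ∣ p ∣
∣p─q∣+∣p∩q∣≡∣p∣ []            []            = refl
∣p─q∣+∣p∩q∣≡∣p∣ (outside ∷ p) (outside ∷ q) = ∣p─q∣+∣p∩q∣≡∣p∣ p q
∣p─q∣+∣p∩q∣≡∣p∣ (outside ∷ p) (inside ∷ q)  = ∣p─q∣+∣p∩q∣≡∣p∣ p q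
∣p─q∣+∣p∩q∣≡∣p∣ (inside ∷ p)  (outside ∷ q) = cong suc (∣p─q∣+∣p∩q∣≡∣p∣ p q)
∣p─q∣+∣p∩q∣≡∣p∣ (inside ∷ p)  (inside ∷ q)  = trans (+-suc ∣ p ─ q ∣ ∣ p ∩ q ∣) (cong suc (∣p─q∣+∣p∩q∣≡∣p∣ p q))

∣p─r∪q∣≤∣p∣ : ∀ {k} (p r q : Subset k) → ∣ q ∣ ≤ ∣ p ∩ r ∣ → ∣ (p ─ r) ∪ q ∣ ≤ ∣ p ∣
∣p─r∪q∣≤∣p∣ p r q ∣q∣≤∣p∩r∣ = begin
  ∣ (p ─ r) ∪ q ∣         ≤⟨ ∣p∪q∣≤∣p∣+∣q∣ (p ─ r) q ⟩
  ∣ p ─ r ∣ + ∣ q ∣       ≤⟨ +-monoʳ-≤ ∣ p ─ r ∣ ∣q∣≤∣p∩r∣ ⟩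
  ∣ p ─ r ∣ + ∣ p ∩ r ∣   ≡⟨ ∣p─q∣+∣p∩q∣≡∣p∣ p r ⟩
  ∣ p ∣                   ∎
  where open ≤-Reasoning

module _ {n m : ℕ} (G : Graph n m) where

  Reach-edge : ∀ {F : Fin m → Set} {f u v} → F f → Joins G f u v → Reach G F u v
  Reach-edge f∈F j = step _ f∈F j here

  Reach-trans : ∀ {F : Fin m → Set} {x y z} → Reach G F x y → Reach G F y z → Reach G F x z
  Reach-trans here             q = q
  Reach-trans (step f f∈F j p) q = step f f∈F j (Reach-trans p q)

  Reach-mono : ∀ {F F′ : Fin m → Set} → (∀ f → F f → F′ f) → ∀ {x y} → Reach G F x y → Reach G F′ x y
  Reach-mono F⊆F′ here             = here
  Reach-mono F⊆F′ (step f f∈F j p) = step f (F⊆F′ f f∈F) j (Reach-mono F⊆F′ p)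

  Reach-last : ∀ {F : Fin m → Set} {x u} → Reach G F x u → x ≡ u ⊎ ∃₂ λ g w → F g × Joins G g w u
  Reach-last here = inj₁ refl
  Reach-last (step g g∈F j p) with Reach-last p
  ... | inj₁ refl = inj₂ (g , _ , g∈F , j)
  ... | inj₂ last = inj₂ last

  Joins-sym : ∀ {f u v} → Joins G f u v → Joins G f v u
  Joins-sym (inj₁ eq) = inj₂ eq
  Joins-sym (inj₂ eq) = inj₁ eq

  module _ {S : Fin n → Set} where

    ES-dec : Decidable S → Decidable (ES G S)
    ES-dec S? f with S? (proj₁ (ends G f)) ⊎-dec S? (proj₂ (ends G f))
    ... | yes Su⊎Sv = yes (_ , _ , refl , Su⊎Sv)
    ... | no ¬Su⊎Sv = no λ (_ , _ , eq , Su⊎Sv) →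
      ¬Su⊎Sv (subst (λ (u , v) → S u ⊎ S v) (sym eq) Su⊎Sv)

    ES-Joins : ∀ {f u v} → ES G S f → Joins G f u v → S u ⊎ S v
    ES-Joins (_ , _ , eq , Su⊎Sv) (inj₁ eq′) with trans (sym eq) eq′
    ... | refl = Su⊎Sv
    ES-Joins (_ , _ , eq , Su⊎Sv) (inj₂ eq′) with trans (sym eq) eq′
    ... | refl = [ inj₂ , inj₁ ]′ Su⊎Sv

    ¬ES-Joins : ∀ {f u v} → ¬ ES G S f → Joins G f u v → ¬ S u × ¬ S v
    ¬ES-Joins ¬ES (inj₁ eq) = (λ Su → ¬ES (_ , _ , eq , inj₁ Su)) , (λ Sv → ¬ES (_ , _ , eq , inj₂ Sv))
    ¬ES-Joins ¬ES (inj₂ eq) = (λ Su → ¬ES (_ , _ , eq , inj₂ Su)) , (λ Sv → ¬ES (_ , _ , eq , inj₁ Sv))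

    ES-Joins-Nbr : ∀ {g w u} → ES G S g → Joins G g w u → ¬ S u → Nbr G S u
    ES-Joins-Nbr g∈ES j ¬Su with ES-Joins g∈ES j
    ... | inj₁ Sw = ¬Su , _ , _ , Sw , Joins-sym j
    ... | inj₂ Su = ⊥-elim (¬Su Su)

  SeparatedPairs : (Fin n → Set) → Subset m → Fin n → Fin n → Set
  SeparatedPairs U X s t = U s × U t × s ≢ t × ¬ Reach G (Minus G (AllEdges G) X) s t

  SeparatedPairs-requests : ∀ {U X} → Requests G U (SeparatedPairs U X)
  SeparatedPairs-requests _ _ (Us , Ut , s≢t , _) = Us , Ut , s≢t

  ⊤-isMulticut : ∀ {U R} → Requests G U R → IsMulticut G (AllEdges G) R Subset.⊤
  ⊤-isMulticut R-req = (λ _ _ → tt) , λ s t r p → proj₂ (proj₂ (R-req s t r)) (isolated p)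
    where
    isolated : ∀ {s t} → Reach G (Minus G (AllEdges G) Subset.⊤) s t → s ≡ t
    isolated here                   = refl
    isolated (step f (_ , f∉⊤) _ _) = ⊥-elim (f∉⊤ ∈⊤)

  ¬¬-minMulticut : ∀ {U R} → Requests G U R → ¬ ¬ ∃ (IsMinMulticut G (AllEdges G) R)
  ¬¬-minMulticut R-req = ¬¬-minimum ∣_∣ (⊤-isMulticut R-req)

  ∩-isMulticut-SeparatedPairs : ∀ {F : Fin m → Set} {U} {E : Subset m} →
    (∀ f → f ∈ E → F f) → (∀ f → F f → f ∈ E) →
    ∀ X → IsMulticut G F (SeparatedPairs U X) (X ∩ E)
  ∩-isMulticut-SeparatedPairs E⊆F F⊆E X =
    (λ f f∈X∩E → E⊆F f (proj₂ (x∈p∩q⁻ X _ f∈X∩E))) ,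
    λ s t (_ , _ , _ , ¬reach) → ¬reach ∘ Reach-mono (λ f (f∈F , f∉X∩E) →
      tt , λ f∈X → f∉X∩E (x∈p∩q⁺ (f∈X , F⊆E f f∈F)))

  SeparatedPairs-refines : ∀ {F : Fin m → Set} {U X Y} → IsMulticut G F (SeparatedPairs U X) Y →
    ∀ {s t} → U s → U t → Reach G (Minus G F Y) s t → ¬ ¬ Reach G (Minus G (AllEdges G) X) s t
  SeparatedPairs-refines (_ , Y-cuts) {s} {t} Us Ut p ¬reach with s ≟ t
  ... | yes refl = ¬reach here
  ... | no s≢t   = Y-cuts s t (Us , Ut , s≢t , ¬reach) p

splice : ∀ {n m} (G : Graph n m) {S : Fin n → Set} → Decidable S → Subset m → Subset m → Subset m
splice G S? X Y = (X ─ fromDec (ES-dec G S?)) ∪ Y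

module Splicing {n m : ℕ} (G : Graph n m) (T : Subset n) {S : Fin n → Set} (S? : Decidable S)
  (X Y : Subset m)
  (Y-refines : ∀ {s t} → TS G T S s → TS G T S t → Reach G (Minus G (ES G S) Y) s t →
               ¬ ¬ Reach G (Minus G (AllEdges G) X) s t)
  where

  RX RY : Fin n → Fin n → Set
  RX = Reach G (Minus G (AllEdges G) X)
  RY = Reach G (Minus G (ES G S) Y)

  Spliced : Fin m → Set
  Spliced f = f ∉ Y × (¬ ES G S f → f ∉ X)

  ¬¬RX-trans : ∀ {x y z} → ¬ ¬ RX x y → ¬ ¬ RX y z → ¬ ¬ RX x z
  ¬¬RX-trans p q k = p λ p′ → q λ q′ → k (Reach-trans G p′ q′)

  TS-end : ∀ {x u} → TS G T S x → RY x u → ¬ S u → TS G T S u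
  TS-end Tx p ¬Su with Reach-last G p
  ... | inj₁ refl                     = Tx
  ... | inj₂ (_ , _ , (g∈ES , _) , j) = inj₂ (ES-Joins-Nbr G g∈ES j ¬Su)

  -- Invariant along a path of G − splice from a: a is (classically) joined to u in G − X
  -- and u ∉ S, or u lies on the current stretch inside G_S, which started at some x ∈ T(S)
  -- joined to a in G − X.
  Linked : Fin n → Fin n → Set
  Linked a u = (¬ ¬ RX a u × ¬ S u) ⊎ ∃ λ x → TS G T S x × ¬ ¬ RX a x × RY x u

  linked-TS : ∀ {a u} → Linked a u → TS G T S u → ¬ ¬ RX a u
  linked-TS (inj₁ (a~u , _))            _  = a~u
  linked-TS (inj₂ (_ , Tx , a~x , x~u)) Tu = ¬¬RX-trans a~x (Y-refines Tx Tu x~u)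

  linked-outside : ∀ {a u} → Linked a u → ¬ S u → ¬ ¬ RX a u
  linked-outside (inj₁ (a~u , _))             _   = a~u
  linked-outside l@(inj₂ (_ , Tx , _ , x~u)) ¬Su = linked-TS l (TS-end Tx x~u ¬Su)

  linked-start : ∀ {a} → a ∈ T → Linked a a
  linked-start {a} a∈T with S? a
  ... | yes Sa = inj₂ (a , inj₁ (a∈T , Sa) , (λ k → k here) , here)
  ... | no ¬Sa = inj₁ ((λ k → k here) , ¬Sa)

  linked-ES-step : ∀ {a u v f} → Linked a u → ES G S f → f ∉ Y → Joins G f u v →
    ∃ λ x → TS G T S x × ¬ ¬ RX a x × RY x v
  linked-ES-step (inj₁ (a~u , ¬Su)) f∈ES f∉Y j =
    _ , inj₂ (ES-Joins-Nbr G f∈ES (Joins-sym G j) ¬Su) , a~u , Reach-edge G (f∈ES , f∉Y) j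
  linked-ES-step (inj₂ (x , Tx , a~x , x~u)) f∈ES f∉Y j =
    x , Tx , a~x , Reach-trans G x~u (Reach-edge G (f∈ES , f∉Y) j)

  linked-step : ∀ {a u v f} → Linked a u → Spliced f → Joins G f u v → Linked a v
  linked-step {f = f} l (f∉Y , ¬ES⇒f∉X) j with ES-dec G S? f
  ... | yes f∈ES = inj₂ (linked-ES-step l f∈ES f∉Y j)
  ... | no f∉ES =
    inj₁ (¬¬-map (λ a~u → Reach-trans G a~u (Reach-edge G (tt , ¬ES⇒f∉X f∉ES) j))
                 (linked-outside l (proj₁ (¬ES-Joins G f∉ES j))) ,
          proj₂ (¬ES-Joins G f∉ES j))

  linked-reach : ∀ {a u w} → Linked a u → Reach G Spliced u w → Linked a w
  linked-reach l here            = l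
  linked-reach l (step _ sp j p) = linked-reach (linked-step l sp j) p

  linked-end : ∀ {a b} → b ∈ T → Linked a b → ¬ ¬ RX a b
  linked-end {b = b} b∈T l with S? b
  ... | yes Sb = linked-TS l (inj₁ (b∈T , Sb))
  ... | no ¬Sb = linked-outside l ¬Sb

  Spliced-reach⇒¬¬RX : ∀ {a b} → a ∈ T → b ∈ T → Reach G Spliced a b → ¬ ¬ RX a b
  Spliced-reach⇒¬¬RX a∈T b∈T p = linked-end b∈T (linked-reach (linked-start a∈T) p)

  ∉splice⇒Spliced : ∀ {f} → f ∉ splice G S? X Y → Spliced f
  ∉splice⇒Spliced f∉ =
    (λ f∈Y → f∉ (x∈p∪q⁺ (inj₂ f∈Y))) ,
    (λ ¬ES f∈X → f∉ (x∈p∪q⁺ (inj₁ (x∈p∧x∉q⇒x∈p─q f∈X (¬ES ∘ ∈-fromDec⁻ (ES-dec G S?))))))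

  splice-isMulticut : ∀ {R} → Requests G (_∈ T) R → IsMulticut G (AllEdges G) R X →
    IsMulticut G (AllEdges G) R (splice G S? X Y)
  splice-isMulticut R-req (_ , X-cuts) = (λ _ _ → tt) , λ s t r p →
    let (s∈T , t∈T , _) = R-req s t r in
    Spliced-reach⇒¬¬RX s∈T t∈T (Reach-mono G (λ _ (_ , f∉) → ∉splice⇒Spliced f∉) p) (X-cuts s t r)

splice-isMinMulticut : ∀ {n m} (G : Graph n m) (T : Subset n) {S : Fin n → Set} (S? : Decidable S)
  {R X Y} → Requests G (_∈ T) R → IsMinMulticut G (AllEdges G) R X →
  IsMinMulticut G (ES G S) (SeparatedPairs G (TS G T S) X) Y →
  IsMinMulticut G (AllEdges G) R (splice G S? X Y)
splice-isMinMulticut {m = m} G T S? {X = X} {Y} R-req (X-cut , X-min) (Y-cut , Y-min) =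
  splice-isMulticut R-req X-cut ,
  λ W W-cut → ≤-trans (∣p─r∪q∣≤∣p∣ X E Y ∣Y∣≤∣X∩E∣) (X-min W W-cut)
  where
  open Splicing G T S? X Y (SeparatedPairs-refines G Y-cut)
  E : Subset m
  E = fromDec (ES-dec G S?)

  ∣Y∣≤∣X∩E∣ : ∣ Y ∣ ≤ ∣ X ∩ E ∣
  ∣Y∣≤∣X∩E∣ = Y-min (X ∩ E) (∩-isMulticut-SeparatedPairs G (λ f → ∈-fromDec⁻ (ES-dec G S?))
                                                         (λ f → ∈-fromDec⁺ (ES-dec G S?)) X)

lemma8 : {n m : ℕ} (G : Graph n m) (T : Subset n) (S : Fin n → Set)
    (Z : Subset m) → MulticutCovering G (ES G S) (TS G T S) Z →
    (e : Fin m) → ES G S e → e ∉ Z → ¬ Essential G T e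
lemma8 G T S Z (_ , covers) e e∈ES e∉Z (R , R-req , e-forced) =
  ¬¬-∀-Fin (λ _ → ¬¬-excluded-middle) λ S? →
  ¬¬-minMulticut G R-req λ (X , X-min) →
  let (Y , Y-min , Y⊆Z) = covers (SeparatedPairs G (TS G T S) X) (SeparatedPairs-requests G)
  in [ (λ e∈X─E → x∈p─q⇒x∉q X _ e∈X─E (∈-fromDec⁺ (ES-dec G S?) e∈ES)) ,
       (λ e∈Y → e∉Z (Y⊆Z e e∈Y)) ]′
     (x∈p∪q⁻ _ Y (e-forced _ (splice-isMinMulticut G T S? R-req X-min Y-min)))
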